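{- Let $\Gamma$ be a finite thick linear space such that the triangle complex $\Delta(\Gamma)$ is a geometry. Then $\Delta(\Gamma)$ is flag-transitive if and only if $\mathrm{Aut}(\Gamma)$ acts transitively on the set $T(\Gamma)$ of ordered triples of non-collinear points of $\Gamma$.
   Context: A linear space is a rank two geometry of points and lines in which every line has at least two points, every point is on at least two lines, and any two distinct points lie on exactly one common line; it is thick if every line has at least three points and every point is on at least three lines. Triangle complex: $\Delta(\Gamma)$ is the rank three incidence system over $\{1,2,3\}$ whose elements are the triples $(p,L,i)$ with $p$ incident with $L$ and $i\in\{1,2,3\}$; the type of $(p,L,i)$ is $i$; and $(p,L,i)$ is incident with $(p',L',i \bmod 3+1)$ if and only if the set of points incident with both $L$ and $L'$ is exactly $\{p\}$ and $p\neq p'$ (incidence symmetric and reflexive, no other incidences). A geometry is an incidence system in which every maximal set of pairwise incident elements (flag) contains an element of each type (a chamber); it is flag-transitive if its type-preserving automorphism group is transitive on chambers. -}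

module Defs where

open import Data.Nat using (ℕ)
open import Data.Fin using (Fin; zero; suc)
open import Data.Bool using (Bool; true)
open import Data.Product using (Σ; ∃; ∃-syntax; _×_; _,_)
open import Data.Sum using (_⊎_)
open import Data.List using (List)
open import Data.List.Membership.Propositional using (_∈_)
open import Relation.Binary.PropositionalEquality using (_≡_; _≢_)
open import Relation.Nullary using (¬_)
open import Function.Bundles using (_↔_; Inverse)
open import Data.Fin.Permutation using (Permutation′; _⟨$⟩ʳ_)

record LinearSpace (v b : ℕ) : Set where
  field
    Inc : Fin v → Fin b → Bool
  _I_ : Fin v → Fin b → Set
  p I L = Inc p L ≡ true
  field
    line≥2  : ∀ (L : Fin b) → Σ (Fin v) λ p → Σ (Fin v) λ q → p ≢ q × p I L × q I L
    point≥2 : ∀ (p : Fin v) → Σ (Fin b) λ L → Σ (Fin b) λ M → L ≢ M × p I L × p I M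
    unique-line : ∀ (p q : Fin v) → p ≢ q →
      Σ (Fin b) λ L → p I L × q I L × (∀ (M : Fin b) → p I M → q I M → M ≡ L)

module _ {v b : ℕ} (Γ : LinearSpace v b) where
  open LinearSpace Γ

  Thick : Set
  Thick =
    (∀ (L : Fin b) → Σ (Fin v) λ p → Σ (Fin v) λ q → Σ (Fin v) λ r →
        p ≢ q × p ≢ r × q ≢ r × p I L × q I L × r I L)
    × (∀ (p : Fin v) → Σ (Fin b) λ L → Σ (Fin b) λ M → Σ (Fin b) λ N →
        L ≢ M × L ≢ N × M ≢ N × p I L × p I M × p I N)

  record Aut : Set where
    field
      σ : Permutation′ v
      τ : Permutation′ b
      preserves : ∀ (p : Fin v) (L : Fin b) → Inc (σ ⟨$⟩ʳ p) (τ ⟨$⟩ʳ L) ≡ Inc p L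

  NonCollinear : Fin v → Fin v → Fin v → Set
  NonCollinear p q r = ¬ (Σ (Fin b) λ L → p I L × q I L × r I L)

  TransitiveOnTriangles : Set
  TransitiveOnTriangles =
    ∀ (p q r p' q' r' : Fin v) → NonCollinear p q r → NonCollinear p' q' r' →
      Σ Aut λ α → let open Aut α in
        (σ ⟨$⟩ʳ p ≡ p') × (σ ⟨$⟩ʳ q ≡ q') × (σ ⟨$⟩ʳ r ≡ r')

  -- The triangle complex Δ(Γ). Types {1,2,3} are encoded as Fin 3
  -- (0 ↦ 1, 1 ↦ 2, 2 ↦ 3).

  record Elem : Set where
    constructor elem
    field
      pt  : Fin v
      ln  : Fin b
      inc : pt I ln
      ty  : Fin 3
  open Elem public

  next : Fin 3 → Fin 3
  next zero = suc zero
  next (suc zero) = suc (suc zero)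
  next (suc (suc zero)) = zero

  Cond : Elem → Elem → Set
  Cond x y =
    (∀ (q : Fin v) → (q I ln x × q I ln y → q ≡ pt x)
                   × (q ≡ pt x → q I ln x × q I ln y))
    × pt x ≢ pt y

  _~_ : Elem → Elem → Set
  x ~ y = x ≡ y
        ⊎ (ty y ≡ next (ty x) × Cond x y)
        ⊎ (ty x ≡ next (ty y) × Cond y x)

  IsFlag : List Elem → Set
  IsFlag F = ∀ {x y : Elem} → x ∈ F → y ∈ F → x ~ y

  _⊆_ : List Elem → List Elem → Set
  F ⊆ G = ∀ {x : Elem} → x ∈ F → x ∈ G

  MaximalFlag : List Elem → Set
  MaximalFlag F = IsFlag F × (∀ (G : List Elem) → IsFlag G → F ⊆ G → G ⊆ F)

  HasAllTypes : List Elem → Set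
  HasAllTypes F = ∀ (i : Fin 3) → Σ Elem λ x → x ∈ F × ty x ≡ i

  Chamber : List Elem → Set
  Chamber F = IsFlag F × HasAllTypes F

  IsGeometry : Set
  IsGeometry = ∀ (F : List Elem) → MaximalFlag F → HasAllTypes F

  record TPAut : Set where
    field
      bij : Elem ↔ Elem
    f : Elem → Elem
    f = Inverse.to bij
    field
      type-pres : ∀ (x : Elem) → ty (f x) ≡ ty x
      inc-pres  : ∀ (x y : Elem) → (x ~ y → f x ~ f y) × (f x ~ f y → x ~ y)

  FlagTransitive : Set
  FlagTransitive =
    ∀ (C D : List Elem) → Chamber C → Chamber D →
      Σ TPAut λ α → let open TPAut α in
        (∀ {x : Elem} → x ∈ C → f x ∈ D)
        × (∀ {y : Elem} → y ∈ D → Σ Elem λ x → x ∈ C × f x ≡ y)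

{-# OPTIONS --safe #-}
module Submission where

-- Write x ◁ y when x and y are incident in Δ(Γ) with ty y = ty x + 1 (mod 3). A type-preserving
-- automorphism f of Δ(Γ) preserves and reflects ◁, hence also the relations "x and y have a
-- common ◁-predecessor" and "... a common ◁-successor". In a thick linear space these relations,
-- read in Γ, recognise when two elements of equal type share their line, and (using the line
-- case for f and f⁻¹) when two elements share their point. So f is induced by a collineation,
-- and it maps the vertex triangle of a chamber to that of the image chamber. Conversely a
-- chamber is a non-collinear triple p₀ p₁ p₂ with the lines p₂p₀, p₀p₁, p₁p₂, so a collineation
-- moving one triangle to another induces an automorphism of Δ(Γ) moving the chambers.

open import Defs
open import Data.Nat using (ℕ)
open import Data.Bool using (Bool; true; false)
import Data.Bool.Properties as Bool
open import Data.Fin using (Fin; zero; suc)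
open import Data.Fin.Properties using (_≟_)
open import Data.Fin.Permutation using (Permutation′; _⟨$⟩ʳ_; _⟨$⟩ˡ_; permutation; inverseˡ; inverseʳ)
open import Data.Product using (Σ; _×_; _,_; proj₁; proj₂)
open import Data.Sum using (_⊎_; inj₁; inj₂)
import Data.Sum as Sum
open import Data.Empty using (⊥-elim)
open import Data.List using (List; []; _∷_)
open import Data.List.Relation.Unary.Any using (here; there)
open import Data.List.Membership.Propositional using (_∈_)
open import Function using (_∘_)
open import Function.Bundles using (_⇔_; mk⇔; Inverse; mk↔ₛ′)
open import Relation.Binary.Definitions using (DecidableEquality)
open import Relation.Binary.PropositionalEquality
open import Relation.Nullary using (¬_; yes; no)
open import Relation.Nullary.Decidable using (decidable-stable)
open import Axiom.UniquenessOfIdentityProofs using (module Decidable⇒UIP)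

one-of-three-avoids-two : ∀ {a p} {A : Set a} {P : A → Set p} → DecidableEquality A →
  ∀ {x y z} → x ≢ y → x ≢ z → y ≢ z → P x → P y → P z →
  (c d : A) → Σ A λ s → P s × s ≢ c × s ≢ d
one-of-three-avoids-two _≟ᴬ_ {x} {y} {z} x≢y x≢z y≢z Px Py Pz c d with x ≟ᴬ c | x ≟ᴬ d
... | no x≢c   | no x≢d = x , Px , x≢c , x≢d
... | yes refl | _ with y ≟ᴬ d
...   | no y≢d   = y , Py , x≢y ∘ sym , y≢d
...   | yes refl = z , Pz , x≢z ∘ sym , y≢z ∘ sym
one-of-three-avoids-two _≟ᴬ_ {x} {y} {z} x≢y x≢z y≢z Px Py Pz c d | no _ | yes refl with y ≟ᴬ c
...   | no y≢c   = y , Py , y≢c , x≢y ∘ sym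
...   | yes refl = z , Pz , y≢z ∘ sym , x≢z ∘ sym

≡true-equivalence⇒≡ : ∀ {a b : Bool} → (a ≡ true → b ≡ true) → (b ≡ true → a ≡ true) → a ≡ b
≡true-equivalence⇒≡ {false} {false} _   _   = refl
≡true-equivalence⇒≡ {false} {true}  _   b⇒a = b⇒a refl
≡true-equivalence⇒≡ {true}  {false} a⇒b _   = sym (a⇒b refl)
≡true-equivalence⇒≡ {true}  {true}  _   _   = refl

permutation-injective : ∀ {n} (π : Permutation′ n) {i j} → π ⟨$⟩ʳ i ≡ π ⟨$⟩ʳ j → i ≡ j
permutation-injective π {i} {j} πi≡πj =
  trans (sym (inverseˡ π)) (trans (cong (π ⟨$⟩ˡ_) πi≡πj) (inverseˡ π))

module _ {v b : ℕ} (Γ : LinearSpace v b) where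
  open LinearSpace Γ

  line-unique : ∀ {p q L M} → p ≢ q → p I L → q I L → p I M → q I M → L ≡ M
  line-unique p≢q pL qL pM qM with unique-line _ _ p≢q
  ... | _ , _ , _ , through-both⇒≡ = trans (through-both⇒≡ _ pL qL) (sym (through-both⇒≡ _ pM qM))

  distinct-lines-meet-once : ∀ {p q L M} → L ≢ M → p I L → p I M → q I L → q I M → p ≡ q
  distinct-lines-meet-once {p} {q} L≢M pL pM qL qM =
    decidable-stable (p ≟ q) λ p≢q → L≢M (line-unique p≢q pL qL pM qM)

  joining-line : ∀ {p q} → p ≢ q → Σ (Fin b) λ L → p I L × q I L
  joining-line p≢q with unique-line _ _ p≢q
  ... | L , pL , qL , _ = L , pL , qL

  some-line-through : ∀ p → Σ (Fin b) (p I_)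
  some-line-through p with point≥2 p
  ... | L , _ , _ , pL , _ = L , pL

  some-point-on : ∀ L → Σ (Fin v) (_I L)
  some-point-on L with line≥2 L
  ... | p , _ , _ , pL , _ = p , pL

  element-at : Fin v → Elem Γ
  element-at p = elem p (proj₁ (some-line-through p)) (proj₂ (some-line-through p)) zero

  element-on : Fin b → Elem Γ
  element-on L = elem (proj₁ (some-point-on L)) L (proj₂ (some-point-on L)) zero

  common-line : ∀ p q → Σ (Fin b) λ L → p I L × q I L
  common-line p q with p ≟ q
  ... | no p≢q   = joining-line p≢q
  ... | yes refl = let (L , pL) = some-line-through p in L , pL , pL

  noncollinear-rotate : ∀ {p q r} → NonCollinear Γ p q r → NonCollinear Γ q r p
  noncollinear-rotate nc (L , qL , rL , pL) = nc (L , pL , qL , rL)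

  noncollinear⇒distinct : ∀ {p q r} → NonCollinear Γ p q r → p ≢ q
  noncollinear⇒distinct {p} {r = r} nc refl with common-line p r
  ... | L , pL , rL = nc (L , pL , pL , rL)

  prev : Fin 3 → Fin 3
  prev zero             = suc (suc zero)
  prev (suc zero)       = zero
  prev (suc (suc zero)) = suc zero

  next-prev : ∀ i → next Γ (prev i) ≡ i
  next-prev zero             = refl
  next-prev (suc zero)       = refl
  next-prev (suc (suc zero)) = refl

  prev-next : ∀ i → prev (next Γ i) ≡ i
  prev-next zero             = refl
  prev-next (suc zero)       = refl
  prev-next (suc (suc zero)) = refl

  next-injective : ∀ {i j} → next Γ i ≡ next Γ j → i ≡ j
  next-injective {i} {j} eq = trans (sym (prev-next i)) (trans (cong prev eq) (prev-next j))

  next≢id : ∀ i → next Γ i ≢ i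
  next≢id zero             ()
  next≢id (suc zero)       ()
  next≢id (suc (suc zero)) ()

  next²≢id : ∀ i → next Γ (next Γ i) ≢ i
  next²≢id zero             ()
  next²≢id (suc zero)       ()
  next²≢id (suc (suc zero)) ()

  type-trichotomy : ∀ i j → i ≡ j ⊎ j ≡ next Γ i ⊎ i ≡ next Γ j
  type-trichotomy zero             zero             = inj₁ refl
  type-trichotomy zero             (suc zero)       = inj₂ (inj₁ refl)
  type-trichotomy zero             (suc (suc zero)) = inj₂ (inj₂ refl)
  type-trichotomy (suc zero)       zero             = inj₂ (inj₂ refl)
  type-trichotomy (suc zero)       (suc zero)       = inj₁ refl
  type-trichotomy (suc zero)       (suc (suc zero)) = inj₂ (inj₁ refl)
  type-trichotomy (suc (suc zero)) zero             = inj₂ (inj₁ refl)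
  type-trichotomy (suc (suc zero)) (suc zero)       = inj₂ (inj₂ refl)
  type-trichotomy (suc (suc zero)) (suc (suc zero)) = inj₁ refl

  Elem-≡ : ∀ {x y : Elem Γ} → pt x ≡ pt y → ln x ≡ ln y → ty x ≡ ty y → x ≡ y
  Elem-≡ {elem p L pL i} {elem .p .L pL′ .i} refl refl refl =
    cong (λ h → elem p L h i) (Decidable⇒UIP.≡-irrelevant Bool._≟_ pL pL′)

  -- Cond x y unfolded: in a linear space, "ln x and ln y meet exactly in pt x"
  -- just says that pt x lies on ln y and the two lines differ.
  infix 4 _◁_
  record _◁_ (x y : Elem Γ) : Set where
    constructor precedes
    field
      type-next : ty y ≡ next Γ (ty x)
      pt-on-ln  : pt x I ln y
      ln≢       : ln x ≢ ln y
      pt≢       : pt x ≢ pt y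
  open _◁_

  Cond⇒◁ : ∀ {x y} → ty y ≡ next Γ (ty x) → Cond Γ x y → x ◁ y
  Cond⇒◁ {x} {y} types (meet , px≢py) = precedes types px∈Ly Lx≢Ly px≢py
    where
    px∈Ly : pt x I ln y
    px∈Ly = proj₂ (proj₂ (meet (pt x)) refl)
    Lx≢Ly : ln x ≢ ln y
    Lx≢Ly Lx≡Ly = px≢py (sym (proj₁ (meet (pt y)) (subst (pt y I_) (sym Lx≡Ly) (inc y) , inc y)))

  ◁⇒Cond : ∀ {x y} → x ◁ y → Cond Γ x y
  ◁⇒Cond {x} {y} x◁y = (λ q → on-both⇒pt q , λ { refl → inc x , pt-on-ln x◁y }) , pt≢ x◁y
    where
    on-both⇒pt : ∀ q → q I ln x × q I ln y → q ≡ pt x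
    on-both⇒pt q (qLx , qLy) = distinct-lines-meet-once (ln≢ x◁y) qLx qLy (inc x) (pt-on-ln x◁y)

  ~-elim : ∀ {x y} → _~_ Γ x y → x ≡ y ⊎ x ◁ y ⊎ y ◁ x
  ~-elim (inj₁ x≡y)            = inj₁ x≡y
  ~-elim (inj₂ (inj₁ (t , c))) = inj₂ (inj₁ (Cond⇒◁ t c))
  ~-elim (inj₂ (inj₂ (t , c))) = inj₂ (inj₂ (Cond⇒◁ t c))

  ~-intro : ∀ {x y} → x ≡ y ⊎ x ◁ y ⊎ y ◁ x → _~_ Γ x y
  ~-intro (inj₁ x≡y)        = inj₁ x≡y
  ~-intro (inj₂ (inj₁ x◁y)) = inj₂ (inj₁ (type-next x◁y , ◁⇒Cond x◁y))
  ~-intro (inj₂ (inj₂ y◁x)) = inj₂ (inj₂ (type-next y◁x , ◁⇒Cond y◁x))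

  ◁-from-~ : ∀ {x y} → ty y ≡ next Γ (ty x) → _~_ Γ x y → x ◁ y
  ◁-from-~ {x} t x~y with ~-elim x~y
  ... | inj₁ refl       = ⊥-elim (next≢id (ty x) (sym t))
  ... | inj₂ (inj₁ x◁y) = x◁y
  ... | inj₂ (inj₂ y◁x) = ⊥-elim (next²≢id (ty x) (sym (trans (type-next y◁x) (cong (next Γ) t))))

  ≡-from-~ : ∀ {x y} → ty x ≡ ty y → _~_ Γ x y → x ≡ y
  ≡-from-~ {x} {y} t x~y with ~-elim x~y
  ... | inj₁ x≡y        = x≡y
  ... | inj₂ (inj₁ x◁y) = ⊥-elim (next≢id (ty x) (sym (trans t (type-next x◁y))))
  ... | inj₂ (inj₂ y◁x) = ⊥-elim (next≢id (ty y) (sym (trans (sym t) (type-next y◁x))))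

  ~-map : (F : Elem Γ → Elem Γ) → (∀ {x y} → x ◁ y → F x ◁ F y) →
          ∀ {x y} → _~_ Γ x y → _~_ Γ (F x) (F y)
  ~-map F F-mono x~y = ~-intro (Sum.map (cong F) (Sum.map F-mono F-mono) (~-elim x~y))

  ~-comap : (F : Elem Γ → Elem Γ) → (∀ {x y} → F x ≡ F y → x ≡ y) → (∀ {x y} → F x ◁ F y → x ◁ y) →
            ∀ {x y} → _~_ Γ (F x) (F y) → _~_ Γ x y
  ~-comap F F-injective F-reflects Fx~Fy =
    ~-intro (Sum.map F-injective (Sum.map F-reflects F-reflects) (~-elim Fx~Fy))

  CommonPredecessor : Elem Γ → Elem Γ → Set
  CommonPredecessor x y = Σ (Elem Γ) λ w → w ◁ x × w ◁ y

  CommonSuccessor : Elem Γ → Elem Γ → Set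
  CommonSuccessor x y = Σ (Elem Γ) λ z → x ◁ z × y ◁ z

  common-successor-sym : ∀ {x y} → CommonSuccessor x y → CommonSuccessor y x
  common-successor-sym (z , x◁z , y◁z) = z , y◁z , x◁z

  common-successor⇒pt∉ln : ∀ {x y} → CommonSuccessor x y → pt x ≢ pt y → ¬ pt x I ln y
  common-successor⇒pt∉ln {x} {y} (z , x◁z , y◁z) px≢py pxLy =
    ln≢ y◁z (line-unique px≢py pxLy (inc y) (pt-on-ln x◁z) (pt-on-ln y◁z))

  collinear⇒¬common-successor : ∀ {x y} → ln x ≡ ln y → pt x ≢ pt y → ¬ CommonSuccessor x y
  collinear⇒¬common-successor {x} Lx≡Ly px≢py xy◁ =
    common-successor⇒pt∉ln xy◁ px≢py (subst (pt x I_) Lx≡Ly (inc x))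

  concurrent⇒¬common-predecessor : ∀ {x y} → pt x ≡ pt y → ln x ≢ ln y → ¬ CommonPredecessor x y
  concurrent⇒¬common-predecessor {x} {y} px≡py Lx≢Ly (w , w◁x , w◁y) =
    pt≢ w◁x (distinct-lines-meet-once Lx≢Ly (pt-on-ln w◁x) (pt-on-ln w◁y)
                                             (inc x) (subst (_I ln y) (sym px≡py) (inc y)))

  module Automorphism (α : TPAut Γ) where
    open TPAut α public

    f⁻¹ : Elem Γ → Elem Γ
    f⁻¹ = Inverse.from bij

    f∘f⁻¹ : ∀ y → f (f⁻¹ y) ≡ y
    f∘f⁻¹ = Inverse.strictlyInverseˡ bij

    f⁻¹∘f : ∀ x → f⁻¹ (f x) ≡ x
    f⁻¹∘f = Inverse.strictlyInverseʳ bij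

    ◁-preserved : ∀ {x y} → x ◁ y → f x ◁ f y
    ◁-preserved {x} {y} x◁y = ◁-from-~ types (proj₁ (inc-pres x y) (~-intro (inj₂ (inj₁ x◁y))))
      where
      types : ty (f y) ≡ next Γ (ty (f x))
      types = trans (type-pres y) (trans (type-next x◁y) (cong (next Γ) (sym (type-pres x))))

    ◁-reflected : ∀ {x y} → f x ◁ f y → x ◁ y
    ◁-reflected {x} {y} fx◁fy = ◁-from-~ types (proj₂ (inc-pres x y) (~-intro (inj₂ (inj₁ fx◁fy))))
      where
      types : ty y ≡ next Γ (ty x)
      types = trans (sym (type-pres y)) (trans (type-next fx◁fy) (cong (next Γ) (type-pres x)))

    common-predecessor-preserved : ∀ {x y} → CommonPredecessor x y → CommonPredecessor (f x) (f y)
    common-predecessor-preserved (w , w◁x , w◁y) = f w , ◁-preserved w◁x , ◁-preserved w◁y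

    common-successor-preserved : ∀ {x y} → CommonSuccessor x y → CommonSuccessor (f x) (f y)
    common-successor-preserved (z , x◁z , y◁z) = f z , ◁-preserved x◁z , ◁-preserved y◁z

    common-predecessor-reflected : ∀ {x y} → CommonPredecessor (f x) (f y) → CommonPredecessor x y
    common-predecessor-reflected {x} {y} (w , w◁fx , w◁fy) =
      f⁻¹ w , ◁-reflected (subst (_◁ f x) (sym (f∘f⁻¹ w)) w◁fx)
            , ◁-reflected (subst (_◁ f y) (sym (f∘f⁻¹ w)) w◁fy)

    common-successor-reflected : ∀ {x y} → CommonSuccessor (f x) (f y) → CommonSuccessor x y
    common-successor-reflected {x} {y} (z , fx◁z , fy◁z) =
      f⁻¹ z , ◁-reflected (subst (f x ◁_) (sym (f∘f⁻¹ z)) fx◁z)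
            , ◁-reflected (subst (f y ◁_) (sym (f∘f⁻¹ z)) fy◁z)

  TPAut-inverse : TPAut Γ → TPAut Γ
  TPAut-inverse α = record
    { bij       = mk↔ₛ′ f⁻¹ f f⁻¹∘f f∘f⁻¹
    ; type-pres = λ x → trans (sym (type-pres (f⁻¹ x))) (cong ty (f∘f⁻¹ x))
    ; inc-pres  = λ x y →
        (λ x~y → proj₂ (inc-pres (f⁻¹ x) (f⁻¹ y)) (subst₂ (_~_ Γ) (sym (f∘f⁻¹ x)) (sym (f∘f⁻¹ y)) x~y)) ,
        (λ f⁻¹x~f⁻¹y → subst₂ (_~_ Γ) (f∘f⁻¹ x) (f∘f⁻¹ y) (proj₁ (inc-pres (f⁻¹ x) (f⁻¹ y)) f⁻¹x~f⁻¹y))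
    }
    where open Automorphism α

  module InducedAutomorphism (β : Aut Γ) where
    open Aut β

    incidence-image : ∀ {p L} → p I L → (σ ⟨$⟩ʳ p) I (τ ⟨$⟩ʳ L)
    incidence-image {p} {L} = trans (preserves p L)

    incidence-preimage : ∀ {p L} → p I L → (σ ⟨$⟩ˡ p) I (τ ⟨$⟩ˡ L)
    incidence-preimage {p} {L} =
      trans (trans (sym (preserves (σ ⟨$⟩ˡ p) (τ ⟨$⟩ˡ L))) (cong₂ Inc (inverseʳ σ) (inverseʳ τ)))

    F : Elem Γ → Elem Γ
    F x = elem (σ ⟨$⟩ʳ pt x) (τ ⟨$⟩ʳ ln x) (incidence-image (inc x)) (ty x)

    F⁻¹ : Elem Γ → Elem Γ
    F⁻¹ x = elem (σ ⟨$⟩ˡ pt x) (τ ⟨$⟩ˡ ln x) (incidence-preimage (inc x)) (ty x)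

    F-injective : ∀ {x y} → F x ≡ F y → x ≡ y
    F-injective Fx≡Fy = Elem-≡ (permutation-injective σ (cong pt Fx≡Fy))
                               (permutation-injective τ (cong ln Fx≡Fy)) (cong ty Fx≡Fy)

    ◁-preserved : ∀ {x y} → x ◁ y → F x ◁ F y
    ◁-preserved x◁y = precedes (type-next x◁y) (incidence-image (pt-on-ln x◁y))
      (ln≢ x◁y ∘ permutation-injective τ) (pt≢ x◁y ∘ permutation-injective σ)

    ◁-reflected : ∀ {x y} → F x ◁ F y → x ◁ y
    ◁-reflected {x} {y} Fx◁Fy = precedes (type-next Fx◁Fy)
      (trans (sym (preserves (pt x) (ln y))) (pt-on-ln Fx◁Fy))
      (ln≢ Fx◁Fy ∘ cong (τ ⟨$⟩ʳ_)) (pt≢ Fx◁Fy ∘ cong (σ ⟨$⟩ʳ_))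

    induced : TPAut Γ
    induced = record
      { bij       = mk↔ₛ′ F F⁻¹ (λ _ → Elem-≡ (inverseʳ σ) (inverseʳ τ) refl)
                                 (λ _ → Elem-≡ (inverseˡ σ) (inverseˡ τ) refl)
      ; type-pres = λ _ → refl
      ; inc-pres  = λ _ _ → ~-map F ◁-preserved , ~-comap F F-injective ◁-reflected
      }

  module ChamberVertices {C : List (Elem Γ)} (chamber : Chamber Γ C) where
    element : Fin 3 → Elem Γ
    element i = proj₁ (proj₂ chamber i)

    element∈ : ∀ i → element i ∈ C
    element∈ i = proj₁ (proj₂ (proj₂ chamber i))

    element-type : ∀ i → ty (element i) ≡ i
    element-type i = proj₂ (proj₂ (proj₂ chamber i))

    vertex : Fin 3 → Fin v
    vertex i = pt (element i)

    member≡element : ∀ {x} → x ∈ C → x ≡ element (ty x)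
    member≡element {x} x∈C = ≡-from-~ (sym (element-type (ty x))) (proj₁ chamber x∈C (element∈ (ty x)))

    element◁ : ∀ i → element (prev i) ◁ element i
    element◁ i = ◁-from-~ types (proj₁ chamber (element∈ (prev i)) (element∈ i))
      where
      types : ty (element i) ≡ next Γ (ty (element (prev i)))
      types = trans (element-type i) (sym (trans (cong (next Γ) (element-type (prev i))) (next-prev i)))

    element-ln-through : ∀ i {N} → vertex (prev i) I N → vertex i I N → ln (element i) ≡ N
    element-ln-through i = line-unique (pt≢ (element◁ i)) (pt-on-ln (element◁ i)) (inc (element i))

    vertices-noncollinear : NonCollinear Γ (vertex zero) (vertex (suc zero)) (vertex (suc (suc zero)))
    vertices-noncollinear (N , v₀N , v₁N , v₂N) =
      ln≢ (element◁ (suc (suc zero)))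
          (trans (element-ln-through (suc zero) v₀N v₁N)
                 (sym (element-ln-through (suc (suc zero)) v₁N v₂N)))

  induced-maps-chamber : (β : Aut Γ) {C D : List (Elem Γ)} (chC : Chamber Γ C) (chD : Chamber Γ D) →
    (∀ i → Aut.σ β ⟨$⟩ʳ ChamberVertices.vertex chC i ≡ ChamberVertices.vertex chD i) →
    let open InducedAutomorphism β in
    (∀ {x} → x ∈ C → F x ∈ D) × (∀ {y} → y ∈ D → Σ (Elem Γ) λ x → x ∈ C × F x ≡ y)
  induced-maps-chamber β {C} {D} chC chD σ-vertex = into , onto
    where
    module C = ChamberVertices chC
    module D = ChamberVertices chD
    open Aut β
    open InducedAutomorphism β
    maps-element : ∀ i → F (C.element i) ≡ D.element i
    maps-element i = Elem-≡ (σ-vertex i) (sym (D.element-ln-through i σ-prev-on σ-on))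
                            (trans (C.element-type i) (sym (D.element-type i)))
      where
      σ-prev-on : D.vertex (prev i) I (τ ⟨$⟩ʳ ln (C.element i))
      σ-prev-on = subst (_I _) (σ-vertex (prev i)) (incidence-image (pt-on-ln (C.element◁ i)))
      σ-on : D.vertex i I (τ ⟨$⟩ʳ ln (C.element i))
      σ-on = subst (_I _) (σ-vertex i) (incidence-image (inc (C.element i)))
    into : ∀ {x} → x ∈ C → F x ∈ D
    into {x} x∈C =
      subst (_∈ D) (sym (trans (cong F (C.member≡element x∈C)) (maps-element (ty x)))) (D.element∈ (ty x))
    onto : ∀ {y} → y ∈ D → Σ (Elem Γ) λ x → x ∈ C × F x ≡ y
    onto {y} y∈D =
      C.element (ty y) , C.element∈ (ty y) , trans (maps-element (ty y)) (sym (D.member≡element y∈D))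

  triangle-transitive⇒flag-transitive : TransitiveOnTriangles Γ → FlagTransitive Γ
  triangle-transitive⇒flag-transitive transitive C D chC chD
    with transitive _ _ _ _ _ _ (ChamberVertices.vertices-noncollinear chC)
                                (ChamberVertices.vertices-noncollinear chD)
  ... | β , σv₀ , σv₁ , σv₂ =
    InducedAutomorphism.induced β ,
    induced-maps-chamber β chC chD λ { zero → σv₀ ; (suc zero) → σv₁ ; (suc (suc zero)) → σv₂ }

  cyclic-triple-is-flag : ∀ {x y z} → x ◁ y → y ◁ z → z ◁ x → IsFlag Γ (x ∷ y ∷ z ∷ [])
  cyclic-triple-is-flag x◁y y◁z z◁x = flag
    where
    flag : IsFlag Γ _
    flag (here refl)                 (here refl)                 = ~-intro (inj₁ refl)
    flag (here refl)                 (there (here refl))         = ~-intro (inj₂ (inj₁ x◁y))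
    flag (here refl)                 (there (there (here refl))) = ~-intro (inj₂ (inj₂ z◁x))
    flag (there (here refl))         (here refl)                 = ~-intro (inj₂ (inj₂ x◁y))
    flag (there (here refl))         (there (here refl))         = ~-intro (inj₁ refl)
    flag (there (here refl))         (there (there (here refl))) = ~-intro (inj₂ (inj₁ y◁z))
    flag (there (there (here refl))) (here refl)                 = ~-intro (inj₂ (inj₁ z◁x))
    flag (there (there (here refl))) (there (here refl))         = ~-intro (inj₂ (inj₂ y◁z))
    flag (there (there (here refl))) (there (there (here refl))) = ~-intro (inj₁ refl)

  noncollinear⇒◁ : ∀ {p q r L M} → NonCollinear Γ p q r → (pL : p I L) → r I L → p I M → (qM : q I M) →
    ∀ i → elem p L pL i ◁ elem q M qM (next Γ i)
  noncollinear⇒◁ {r = r} nc pL rL pM qM i =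
    precedes refl pM (λ L≡M → nc (_ , pM , qM , subst (r I_) L≡M rL)) (noncollinear⇒distinct nc)

  module Triangle {p q r : Fin v} (nc : NonCollinear Γ p q r) where
    private
      qrp : NonCollinear Γ q r p
      qrp = noncollinear-rotate nc
      rpq : NonCollinear Γ r p q
      rpq = noncollinear-rotate qrp
      side-rp : Σ (Fin b) λ L → r I L × p I L
      side-rp = joining-line (noncollinear⇒distinct rpq)
      side-pq : Σ (Fin b) λ L → p I L × q I L
      side-pq = joining-line (noncollinear⇒distinct nc)
      side-qr : Σ (Fin b) λ L → q I L × r I L
      side-qr = joining-line (noncollinear⇒distinct qrp)
      x₀ x₁ x₂ : Elem Γ
      x₀ = elem p (proj₁ side-rp) (proj₂ (proj₂ side-rp)) zero
      x₁ = elem q (proj₁ side-pq) (proj₂ (proj₂ side-pq)) (suc zero)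
      x₂ = elem r (proj₁ side-qr) (proj₂ (proj₂ side-qr)) (suc (suc zero))

    chamber : List (Elem Γ)
    chamber = x₀ ∷ x₁ ∷ x₂ ∷ []

    is-chamber : Chamber Γ chamber
    is-chamber = cyclic-triple-is-flag
                   (noncollinear⇒◁ nc  (proj₂ (proj₂ side-rp)) (proj₁ (proj₂ side-rp))
                                       (proj₁ (proj₂ side-pq)) (proj₂ (proj₂ side-pq)) zero)
                   (noncollinear⇒◁ qrp (proj₂ (proj₂ side-pq)) (proj₁ (proj₂ side-pq))
                                       (proj₁ (proj₂ side-qr)) (proj₂ (proj₂ side-qr)) (suc zero))
                   (noncollinear⇒◁ rpq (proj₂ (proj₂ side-qr)) (proj₁ (proj₂ side-qr))
                                       (proj₁ (proj₂ side-rp)) (proj₂ (proj₂ side-rp)) (suc (suc zero)))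
               , all-types
      where
      all-types : HasAllTypes Γ chamber
      all-types zero             = x₀ , here refl , refl
      all-types (suc zero)       = x₁ , there (here refl) , refl
      all-types (suc (suc zero)) = x₂ , there (there (here refl)) , refl

  module _ (thick : Thick Γ) where

    point-avoiding : ∀ L c d → Σ (Fin v) λ s → s I L × s ≢ c × s ≢ d
    point-avoiding L with proj₁ thick L
    ... | _ , _ , _ , p≢q , p≢r , q≢r , pL , qL , rL =
      one-of-three-avoids-two {P = _I L} _≟_ p≢q p≢r q≢r pL qL rL

    line-avoiding : ∀ p A B → Σ (Fin b) λ K → p I K × K ≢ A × K ≢ B
    line-avoiding p with proj₂ thick p
    ... | _ , _ , _ , L≢M , L≢N , M≢N , pL , pM , pN =
      one-of-three-avoids-two {P = p I_} _≟_ L≢M L≢N M≢N pL pM pN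

    meeting-point⇒common-predecessor : ∀ {x y c} → ty x ≡ ty y → c I ln x → c I ln y → c ≢ pt x → c ≢ pt y →
      CommonPredecessor x y
    meeting-point⇒common-predecessor {x} {y} {c} tx≡ty cLx cLy c≢px c≢py
      with line-avoiding c (ln x) (ln y)
    ... | K , cK , K≢Lx , K≢Ly =
      elem c K cK (prev (ty x)) , precedes (sym (next-prev (ty x))) cLx K≢Lx c≢px
                                , precedes (trans (sym tx≡ty) (sym (next-prev (ty x)))) cLy K≢Ly c≢py

    joining-line⇒common-successor : ∀ {x y M} → ty x ≡ ty y → pt x I M → pt y I M → ln x ≢ M → ln y ≢ M →
      CommonSuccessor x y
    joining-line⇒common-successor {x} {y} {M} tx≡ty pxM pyM Lx≢M Ly≢M with point-avoiding M (pt x) (pt y)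
    ... | s , sM , s≢px , s≢py =
      elem s M sM (next Γ (ty x)) , precedes refl pxM Lx≢M (s≢px ∘ sym)
                                  , precedes (cong (next Γ) tx≡ty) pyM Ly≢M (s≢py ∘ sym)

    collinear⇒common-predecessor : ∀ {x y} → ty x ≡ ty y → ln x ≡ ln y → CommonPredecessor x y
    collinear⇒common-predecessor {x} {y} tx≡ty Lx≡Ly with point-avoiding (ln x) (pt x) (pt y)
    ... | c , cLx , c≢px , c≢py =
      meeting-point⇒common-predecessor tx≡ty cLx (subst (c I_) Lx≡Ly cLx) c≢px c≢py

    concurrent⇒common-successor : ∀ {x y} → ty x ≡ ty y → pt x ≡ pt y → CommonSuccessor x y
    concurrent⇒common-successor {x} {y} tx≡ty px≡py with line-avoiding (pt x) (ln x) (ln y)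
    ... | M , pxM , M≢Lx , M≢Ly =
      joining-line⇒common-successor tx≡ty pxM (subst (_I M) px≡py pxM) (M≢Lx ∘ sym) (M≢Ly ∘ sym)

    common-predecessor⇒common-successor : ∀ {x y} → ln x ≢ ln y →
      CommonPredecessor x y → CommonSuccessor x y
    common-predecessor⇒common-successor {x} {y} Lx≢Ly (w , w◁x , w◁y) =
      let (M , pxM , pyM) = joining-line px≢py in
      joining-line⇒common-successor tx≡ty pxM pyM
        (λ Lx≡M → pt≢ w◁y (only-pt-w (subst (pt y I_) (sym Lx≡M) pyM) (inc y)))
        (λ Ly≡M → pt≢ w◁x (only-pt-w (inc x) (subst (pt x I_) (sym Ly≡M) pxM)))
      where
      tx≡ty : ty x ≡ ty y
      tx≡ty = trans (type-next w◁x) (sym (type-next w◁y))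
      only-pt-w : ∀ {q} → q I ln x → q I ln y → pt w ≡ q
      only-pt-w = distinct-lines-meet-once Lx≢Ly (pt-on-ln w◁x) (pt-on-ln w◁y)
      px≢py : pt x ≢ pt y
      px≢py px≡py = pt≢ w◁x (only-pt-w (inc x) (subst (_I ln y) (sym px≡py) (inc y)))

    common-successor⇒common-predecessor : ∀ {x y c} → pt x ≢ pt y → CommonSuccessor x y →
      c I ln x → c I ln y → CommonPredecessor x y
    common-successor⇒common-predecessor {x} {y} px≢py xy◁ cLx cLy =
      meeting-point⇒common-predecessor tx≡ty cLx cLy
        (λ { refl → common-successor⇒pt∉ln xy◁ px≢py cLy })
        (λ { refl → common-successor⇒pt∉ln (common-successor-sym xy◁) (px≢py ∘ sym) cLx })
      where
      tx≡ty : ty x ≡ ty y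
      tx≡ty = next-injective (trans (sym (type-next (proj₁ (proj₂ xy◁)))) (type-next (proj₂ (proj₂ xy◁))))

    module SameTypeImages (α : TPAut Γ) where
      open Automorphism α

      same-ln-and-type⇒same-image-ln : ∀ {x y} → ty x ≡ ty y → ln x ≡ ln y → ln (f x) ≡ ln (f y)
      same-ln-and-type⇒same-image-ln {x} {y} tx≡ty Lx≡Ly with pt x ≟ pt y
      ... | yes px≡py = cong (ln ∘ f) (Elem-≡ px≡py Lx≡Ly tx≡ty)
      ... | no px≢py  = decidable-stable (ln (f x) ≟ ln (f y)) λ fLx≢fLy →
        collinear⇒¬common-successor Lx≡Ly px≢py
          (common-successor-reflected (common-predecessor⇒common-successor fLx≢fLy
            (common-predecessor-preserved (collinear⇒common-predecessor tx≡ty Lx≡Ly))))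

      concurrent-image-lines-meet : ∀ {x y} → ty x ≡ ty y → pt x ≡ pt y →
        Σ (Fin v) λ c → c I ln (f x) × c I ln (f y)
      concurrent-image-lines-meet {x} {y} tx≡ty px≡py
        with point-avoiding (ln x) (pt x) (pt x) | point-avoiding (ln y) (pt x) (pt x)
      ... | q , qLx , q≢px , _ | q′ , q′Ly , q′≢px , _ =
        let (w , w◁fx̃ , w◁fỹ) = common-predecessor-preserved pair in
        pt w , subst (pt w I_) (same-ln-and-type⇒same-image-ln {x̃} {x} refl refl) (pt-on-ln w◁fx̃)
             , subst (pt w I_) (same-ln-and-type⇒same-image-ln {ỹ} {y} refl refl) (pt-on-ln w◁fỹ)
        where
        x̃ ỹ : Elem Γ
        x̃ = elem q (ln x) qLx (ty x)
        ỹ = elem q′ (ln y) q′Ly (ty y)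
        pair : CommonPredecessor x̃ ỹ
        pair = meeting-point⇒common-predecessor tx≡ty (inc x) (subst (_I ln y) (sym px≡py) (inc y))
                                                 (q≢px ∘ sym) (q′≢px ∘ sym)

      same-pt-and-type⇒same-image-pt : ∀ {x y} → ty x ≡ ty y → pt x ≡ pt y → pt (f x) ≡ pt (f y)
      same-pt-and-type⇒same-image-pt {x} {y} tx≡ty px≡py with ln x ≟ ln y
      ... | yes Lx≡Ly = cong (pt ∘ f) (Elem-≡ px≡py Lx≡Ly tx≡ty)
      ... | no Lx≢Ly  = decidable-stable (pt (f x) ≟ pt (f y)) λ fpx≢fpy →
        let (c , cLfx , cLfy) = concurrent-image-lines-meet tx≡ty px≡py in
        concurrent⇒¬common-predecessor px≡py Lx≢Ly
          (common-predecessor-reflected (common-successor⇒common-predecessor fpx≢fpy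
            (common-successor-preserved (concurrent⇒common-successor tx≡ty px≡py)) cLfx cLfy))

    module InducedCollineation (α : TPAut Γ) where
      open Automorphism α
      open SameTypeImages α
      private module α⁻¹ = SameTypeImages (TPAut-inverse α)

      image-pts-on-image-line : ∀ {x y} → ty y ≡ next Γ (ty x) → pt x ≡ pt y →
        ∀ z → pt z ≡ pt x → ty z ≡ ty y → pt (f x) I ln (f z) × pt (f y) I ln (f z)
      image-pts-on-image-line {x} {y} ty≡next px≡py z pz≡px tz≡ty
        with line-avoiding (pt z) (ln z) (ln z) | point-avoiding (ln z) (pt z) (pt z)
      ... | O , pO , O≢Lz , _ | s , sLz , s≢pz , _ =
        subst₂ _I_ (same-pt-and-type⇒same-image-pt {xO} {x} refl pz≡px)
                   (same-ln-and-type⇒same-image-ln {yz} {z} (sym tz≡ty) refl)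
                   (pt-on-ln (◁-preserved xO◁yz)) ,
        subst (_I ln (f z)) (same-pt-and-type⇒same-image-pt {z} {y} tz≡ty (trans pz≡px px≡py)) (inc (f z))
        where
        xO yz : Elem Γ
        xO = elem (pt z) O pO (ty x)
        yz = elem s (ln z) sLz (ty y)
        xO◁yz : xO ◁ yz
        xO◁yz = precedes ty≡next (inc z) O≢Lz (s≢pz ∘ sym)

      -- Both image points lie on the image line of every element (pt x, N, ty y); two lines N
      -- through pt x have distinct image lines because f⁻¹ respects lines too.
      same-pt-next-type⇒same-image-pt : ∀ {x y} → ty y ≡ next Γ (ty x) → pt x ≡ pt y → pt (f x) ≡ pt (f y)
      same-pt-next-type⇒same-image-pt {x} {y} ty≡next px≡py with point≥2 (pt x)
      ... | N₁ , N₂ , N₁≢N₂ , pN₁ , pN₂ = decidable-stable (pt (f x) ≟ pt (f y)) λ fpx≢fpy →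
        N₁≢N₂ (begin
          N₁                ≡⟨ cong ln (sym (f⁻¹∘f z₁)) ⟩
          ln (f⁻¹ (f z₁))   ≡⟨ α⁻¹.same-ln-and-type⇒same-image-ln
                                 (trans (type-pres z₁) (sym (type-pres z₂)))
                                 (line-unique fpx≢fpy (proj₁ on₁) (proj₂ on₁) (proj₁ on₂) (proj₂ on₂)) ⟩
          ln (f⁻¹ (f z₂))   ≡⟨ cong ln (f⁻¹∘f z₂) ⟩
          N₂                ∎)
        where
        open ≡-Reasoning
        z₁ z₂ : Elem Γ
        z₁ = elem (pt x) N₁ pN₁ (ty y)
        z₂ = elem (pt x) N₂ pN₂ (ty y)
        on₁ : pt (f x) I ln (f z₁) × pt (f y) I ln (f z₁)
        on₁ = image-pts-on-image-line ty≡next px≡py z₁ refl refl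
        on₂ : pt (f x) I ln (f z₂) × pt (f y) I ln (f z₂)
        on₂ = image-pts-on-image-line ty≡next px≡py z₂ refl refl

      same-pt⇒same-image-pt : ∀ {x y} → pt x ≡ pt y → pt (f x) ≡ pt (f y)
      same-pt⇒same-image-pt {x} {y} px≡py with type-trichotomy (ty x) (ty y)
      ... | inj₁ tx≡ty          = same-pt-and-type⇒same-image-pt tx≡ty px≡py
      ... | inj₂ (inj₁ ty≡next) = same-pt-next-type⇒same-image-pt ty≡next px≡py
      ... | inj₂ (inj₂ tx≡next) = sym (same-pt-next-type⇒same-image-pt tx≡next (sym px≡py))

      point-image : Fin v → Fin v
      point-image p = pt (f (element-at p))

      line-image : Fin b → Fin b
      line-image L = ln (f (element-on L))

      pt-image : ∀ x → pt (f x) ≡ point-image (pt x)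
      pt-image x = same-pt⇒same-image-pt refl

      ln-image : ∀ x → ty x ≡ zero → ln (f x) ≡ line-image (ln x)
      ln-image x tx≡0 = same-ln-and-type⇒same-image-ln tx≡0 refl

      incidence-image : ∀ {p L} → p I L → point-image p I line-image L
      incidence-image {p} {L} pL = subst₂ _I_ (pt-image x) (ln-image x refl) (inc (f x))
        where
        x : Elem Γ
        x = elem p L pL zero

    module _ (α β : TPAut Γ) (βα≡id : ∀ x → TPAut.f β (TPAut.f α x) ≡ x) where
      private
        module α = InducedCollineation α
        module β = InducedCollineation β

      point-image-inverse : ∀ p → β.point-image (α.point-image p) ≡ p
      point-image-inverse p = trans (sym (β.pt-image (TPAut.f α x))) (cong pt (βα≡id x))
        where
        x : Elem Γ
        x = element-at p

      line-image-inverse : ∀ L → β.line-image (α.line-image L) ≡ L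
      line-image-inverse L = trans (sym (β.ln-image (TPAut.f α x) (TPAut.type-pres α x))) (cong ln (βα≡id x))
        where
        x : Elem Γ
        x = element-on L

    collineation : TPAut Γ → Aut Γ
    collineation α = record
      { σ         = permutation α.point-image α⁻¹.point-image
                      (point-image-inverse α⁻¹ α f∘f⁻¹) (point-image-inverse α α⁻¹ f⁻¹∘f)
      ; τ         = permutation α.line-image α⁻¹.line-image
                      (line-image-inverse α⁻¹ α f∘f⁻¹) (line-image-inverse α α⁻¹ f⁻¹∘f)
      ; preserves = λ p L → ≡true-equivalence⇒≡
          (subst₂ _I_ (point-image-inverse α α⁻¹ f⁻¹∘f p) (line-image-inverse α α⁻¹ f⁻¹∘f L)
           ∘ α⁻¹.incidence-image)
          α.incidence-image
      }
      where
      open Automorphism α using (f∘f⁻¹; f⁻¹∘f)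
      α⁻¹ : TPAut Γ
      α⁻¹ = TPAut-inverse α
      module α = InducedCollineation α
      module α⁻¹ = InducedCollineation α⁻¹

    collineation-maps-vertices : (α : TPAut Γ) {C D : List (Elem Γ)} →
      (chC : Chamber Γ C) (chD : Chamber Γ D) →
      (∀ {x} → x ∈ C → TPAut.f α x ∈ D) →
      ∀ i → InducedCollineation.point-image α (ChamberVertices.vertex chC i) ≡ ChamberVertices.vertex chD i
    collineation-maps-vertices α chC chD maps i = begin
      point-image (C.vertex i)        ≡⟨ sym (pt-image (C.element i)) ⟩
      pt (f (C.element i))            ≡⟨ cong pt (D.member≡element (maps (C.element∈ i))) ⟩
      D.vertex (ty (f (C.element i))) ≡⟨ cong D.vertex (trans (type-pres _) (C.element-type i)) ⟩
      D.vertex i                      ∎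
      where
      open ≡-Reasoning
      open Automorphism α using (f; type-pres)
      open InducedCollineation α
      module C = ChamberVertices chC
      module D = ChamberVertices chD

    flag-transitive⇒triangle-transitive : FlagTransitive Γ → TransitiveOnTriangles Γ
    flag-transitive⇒triangle-transitive transitive p q r p′ q′ r′ nc nc′
      with transitive _ _ (Triangle.is-chamber nc) (Triangle.is-chamber nc′)
    ... | α , maps , _ =
      collineation α , vertex-image zero , vertex-image (suc zero) , vertex-image (suc (suc zero))
      where
      vertex-image : ∀ i → InducedCollineation.point-image α (ChamberVertices.vertex (Triangle.is-chamber nc) i)
                           ≡ ChamberVertices.vertex (Triangle.is-chamber nc′) i
      vertex-image = collineation-maps-vertices α (Triangle.is-chamber nc) (Triangle.is-chamber nc′) maps

theorem3p10 : ∀ {v b : ℕ} (Γ : LinearSpace v b) → Thick Γ → IsGeometry Γ →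
    (FlagTransitive Γ ⇔ TransitiveOnTriangles Γ)
theorem3p10 Γ thick _ =
  mk⇔ (flag-transitive⇒triangle-transitive Γ thick) (triangle-transitive⇒flag-transitive Γ)
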